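{- Let $G$ be a connected graph with $\mathrm{diam}(G)=k\ge 2$. If $F$ is a set of edges of $G$ such that $d(e,f)=k$ for all distinct $e,f\in F$, then $\mathrm{gp}(G)\ge 2|F|$.
   Context: For edges $e=uv$ and $f=xy$ of $G$, $d(e,f)=\min\{d(u,x),d(u,y),d(v,x),d(v,y)\}$. $\mathrm{diam}(G)$ is the maximum distance between two vertices of $G$. A set of vertices is a general position set if no three distinct vertices of it lie on a common geodesic (shortest path) of $G$; $\mathrm{gp}(G)$ is the maximum cardinality of a general position set of $G$. -}

module Defs where

open import Data.Nat using (ℕ; zero; suc; _≤_; _⊓_)
open import Data.Fin using (Fin)
open import Data.Product using (Σ; ∃; _×_; _,_; proj₁; proj₂)
open import Data.List using (List; length)
open import Data.List.Membership.Propositional using (_∈_)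
open import Data.List.Relation.Unary.Unique.Propositional using (Unique)
open import Relation.Nullary using (¬_)
open import Relation.Binary using (Decidable)
open import Relation.Binary.PropositionalEquality using (_≡_; _≢_)

record Graph (n : ℕ) : Set₁ where
  field
    Adj     : Fin n → Fin n → Set
    adj?    : Decidable Adj
    sym     : ∀ {u v} → Adj u v → Adj v u
    irrefl  : ∀ {u} → ¬ Adj u u
open Graph public

module _ {n : ℕ} (G : Graph n) where

  data Walk : Fin n → Fin n → ℕ → Set where
    [] : ∀ {u} → Walk u u 0
    _∷_ : ∀ {u v w l} → Adj G u v → Walk v w l → Walk u w (suc l)

  data OnWalk (x : Fin n) : ∀ {u v l} → Walk u v l → Set where
    here  : ∀ {v l} {w : Walk x v l} → OnWalk x w
    there : ∀ {u u' v l} {a : Adj G u u'} {w : Walk u' v l} → OnWalk x w → OnWalk x (a ∷ w)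

  Dist : Fin n → Fin n → ℕ → Set
  Dist u v d = Walk u v d × (∀ m → Walk u v m → d ≤ m)

  IsGeodesic : ∀ {u v l} → Walk u v l → Set
  IsGeodesic {u} {v} {l} _ = ∀ m → Walk u v m → l ≤ m

  Connected : Set
  Connected = ∀ u v → ∃ λ l → Walk u v l

  Diam : ℕ → Set
  Diam k = (∀ u v d → Dist u v d → d ≤ k) × (∃ λ u → ∃ λ v → Dist u v k)

  -- Edge as an ordered pair of adjacent vertices (uv and vu denote the same edge)
  Edge : Set
  Edge = Σ (Fin n × Fin n) λ p → Adj G (proj₁ p) (proj₂ p)

  EdgeDist : Edge → Edge → ℕ → Set
  EdgeDist ((u , v) , _) ((x , y) , _) k =
    ∃ λ a → ∃ λ b → ∃ λ c → ∃ λ d →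
      Dist u x a × Dist u y b × Dist v x c × Dist v y d ×
      (a ⊓ (b ⊓ (c ⊓ d)) ≡ k)

  GeneralPosition : List (Fin n) → Set
  GeneralPosition S =
    ∀ x y z → x ∈ S → y ∈ S → z ∈ S → x ≢ y → y ≢ z → x ≢ z →
      ¬ (Σ (Fin n) λ u → Σ (Fin n) λ v → Σ ℕ λ l → Σ (Walk u v l) λ w →
           IsGeodesic w × OnWalk x w × OnWalk y w × OnWalk z w)

  GpAtLeast : ℕ → Set
  GpAtLeast t = ∃ λ S → Unique S × GeneralPosition S × t ≤ length S

-- Let S be the set of the 2|F| endpoints of the edges in F; endpoints of distinct edges of F
-- are at distance exactly k. If three vertices of S lay on a geodesic, the middle one b would
-- satisfy d(a,b) + d(b,c) = d(a,c). When a and c are the ends of one edge this reads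
-- 2 ≤ d(a,b) + d(b,c) = 1. Otherwise d(a,c) = k, while b lies on an edge other than that of a
-- or other than that of c, so one of d(a,b), d(b,c) is k and the other positive: k + 1 ≤ k.
module Submission where

open import Defs
open import Data.Nat using (ℕ; zero; suc; _≤_; _*_; _+_; z≤n; s≤s)
open import Data.Nat.Properties
open import Data.Fin using (Fin) renaming (zero to fzero; suc to fsuc)
open import Data.Fin.Properties using () renaming (_≟_ to _≟ᶠ_; suc-injective to fsuc-injective)
open import Data.Product using (∃; ∃₂; _×_; _,_; proj₁; proj₂)
open import Data.Sum using (_⊎_; inj₁; inj₂)
open import Data.Empty using (⊥-elim)
open import Data.List using (List; []; _∷_; length)
open import Data.List.Membership.Propositional using (_∈_)
open import Data.List.Relation.Unary.Any using (here; there)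
import Data.List.Relation.Unary.All as All
open import Data.List.Relation.Unary.AllPairs using ([]; _∷_)
open import Data.List.Relation.Unary.Unique.Propositional using (Unique)
open import Relation.Nullary using (¬_; yes; no)
open import Relation.Binary.PropositionalEquality
  using (_≡_; refl; _≢_; ≢-sym; cong; subst; module ≡-Reasoning) renaming (sym to ≡-sym)

module _ {n : ℕ} (G : Graph n) where

  _++ʷ_ : ∀ {u v w a b} → Walk G u v a → Walk G v w b → Walk G u w (a + b)
  []      ++ʷ q = q
  (e ∷ p) ++ʷ q = e ∷ (p ++ʷ q)

  walk-length-positive : ∀ {x y l} → x ≢ y → Walk G x y l → 1 ≤ l
  walk-length-positive x≢y []      = ⊥-elim (x≢y refl)
  walk-length-positive x≢y (_ ∷ _) = s≤s z≤n

  position : ∀ {x u v l} {w : Walk G u v l} → OnWalk G x w → ℕ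
  position here      = 0
  position (there o) = suc (position o)

  prefix : ∀ {x u v l} {w : Walk G u v l} (o : OnWalk G x w) → Walk G u x (position o)
  prefix here              = []
  prefix (there {a = e} o) = e ∷ prefix o

  suffix : ∀ {x u v l} {w : Walk G u v l} (o : OnWalk G x w) →
           ∃ λ s → Walk G x v s × position o + s ≡ l
  suffix {w = w} here = _ , w , refl
  suffix (there o) with suffix o
  ... | s , q , eq = s , q , cong suc eq

  segment : ∀ {x y u v l} {w : Walk G u v l} (ox : OnWalk G x w) (oy : OnWalk G y w) →
            position ox ≤ position oy → ∃ λ s → Walk G x y s × position ox + s ≡ position oy
  segment here       oy         _         = _ , prefix oy , refl
  segment (there ox) (there oy) (s≤s le) with segment ox oy le
  ... | s , q , eq = s , q , cong suc eq

  -- Replacing the part of a geodesic between x and z by another x–z walk cannot shorten it.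
  geodesic-shortcut : ∀ {x z u v l} {w : Walk G u v l} → IsGeodesic G w →
                      (ox : OnWalk G x w) (oz : OnWalk G z w) →
                      ∀ {D} → Walk G x z D → position oz ≤ position ox + D
  geodesic-shortcut geo ox oz {D} r with suffix oz
  ... | s , q , eq = +-cancelʳ-≤ s (position oz) (position ox + D) (begin
    position oz + s          ≡⟨ eq ⟩
    _                        ≤⟨ geo _ (prefix ox ++ʷ (r ++ʷ q)) ⟩
    position ox + (D + s)    ≡⟨ +-assoc (position ox) D s ⟨
    position ox + D + s      ∎)
    where open ≤-Reasoning

  Between : Fin n → Fin n → Fin n → Set
  Between x y z = ∃₂ λ s t → Walk G x y s × Walk G y z t × (∀ D → Walk G x z D → s + t ≤ D)

  geodesic-between : ∀ {x y z u v l} {w : Walk G u v l} → IsGeodesic G w →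
                     (ox : OnWalk G x w) (oy : OnWalk G y w) (oz : OnWalk G z w) →
                     position ox ≤ position oy → position oy ≤ position oz → Between x y z
  geodesic-between geo ox oy oz x≤y y≤z with segment ox oy x≤y | segment oy oz y≤z
  ... | s , p , eq₁ | t , q , eq₂ = s , t , p , q , λ D r →
    +-cancelˡ-≤ (position ox) (s + t) D (begin
      position ox + (s + t)   ≡⟨ +-assoc (position ox) s t ⟨
      position ox + s + t     ≡⟨ cong (_+ t) eq₁ ⟩
      position oy + t         ≡⟨ eq₂ ⟩
      position oz             ≤⟨ geodesic-shortcut geo ox oz r ⟩
      position ox + D         ∎)
    where open ≤-Reasoning

  generalPosition-if-noneBetween :
    ∀ {S} → (∀ {x y z} → x ∈ S → y ∈ S → z ∈ S → x ≢ y → y ≢ z → ¬ Between x y z) →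
    GeneralPosition G S
  generalPosition-if-noneBetween none x y z x∈ y∈ z∈ x≢y y≢z x≢z (_ , _ , _ , _ , geo , ox , oy , oz)
    with ≤-total (position ox) (position oy)
       | ≤-total (position oy) (position oz)
       | ≤-total (position ox) (position oz)
  ... | inj₁ x≤y | inj₁ y≤z | _        = none x∈ y∈ z∈ x≢y y≢z (geodesic-between geo ox oy oz x≤y y≤z)
  ... | inj₁ x≤y | inj₂ z≤y | inj₁ x≤z = none x∈ z∈ y∈ x≢z (≢-sym y≢z) (geodesic-between geo ox oz oy x≤z z≤y)
  ... | inj₁ x≤y | inj₂ z≤y | inj₂ z≤x = none z∈ x∈ y∈ (≢-sym x≢z) x≢y (geodesic-between geo oz ox oy z≤x x≤y)
  ... | inj₂ y≤x | inj₁ y≤z | inj₁ x≤z = none y∈ x∈ z∈ (≢-sym x≢y) x≢z (geodesic-between geo oy ox oz y≤x x≤z)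
  ... | inj₂ y≤x | inj₁ y≤z | inj₂ z≤x = none y∈ z∈ x∈ y≢z (≢-sym x≢z) (geodesic-between geo oy oz ox y≤z z≤x)
  ... | inj₂ y≤x | inj₂ z≤y | _        = none z∈ y∈ x∈ (≢-sym y≢z) (≢-sym x≢y) (geodesic-between geo oz oy ox z≤y y≤x)

  EndpointOf : Edge G → Fin n → Set
  EndpointOf ((u , v) , _) x = x ≡ u ⊎ x ≡ v

  endpoints : ∀ {m} → (Fin m → Edge G) → List (Fin n)
  endpoints {zero}  F = []
  endpoints {suc m} F = proj₁ (proj₁ (F fzero)) ∷ proj₂ (proj₁ (F fzero)) ∷ endpoints (λ i → F (fsuc i))

  length-endpoints : ∀ {m} (F : Fin m → Edge G) → length (endpoints F) ≡ 2 * m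
  length-endpoints {zero}  F = refl
  length-endpoints {suc m} F = begin
    2 + length (endpoints (λ i → F (fsuc i)))   ≡⟨ cong (2 +_) (length-endpoints (λ i → F (fsuc i))) ⟩
    2 + 2 * m                                   ≡⟨ *-distribˡ-+ 2 1 m ⟨
    2 * suc m                                   ∎
    where open ≡-Reasoning

  ∈-endpoints⁻ : ∀ {m} (F : Fin m → Edge G) {x} → x ∈ endpoints F → ∃ λ i → EndpointOf (F i) x
  ∈-endpoints⁻ {suc m} F (here eq)         = fzero , inj₁ eq
  ∈-endpoints⁻ {suc m} F (there (here eq)) = fzero , inj₂ eq
  ∈-endpoints⁻ {suc m} F (there (there x∈)) with ∈-endpoints⁻ (λ i → F (fsuc i)) x∈
  ... | i , end = fsuc i , end

  endpoints-unique : ∀ {m} (F : Fin m → Edge G) →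
    (∀ {i j x} → i ≢ j → EndpointOf (F i) x → ¬ EndpointOf (F j) x) → Unique (endpoints F)
  endpoints-unique {zero}  F disjoint = []
  endpoints-unique {suc m} F disjoint =
    All.tabulate u≢ ∷ All.tabulate v≢ ∷ endpoints-unique F⁺ (λ i≢j → disjoint (λ eq → i≢j (fsuc-injective eq)))
    where
      F⁺ = λ i → F (fsuc i)
      u = proj₁ (proj₁ (F fzero))
      v = proj₂ (proj₁ (F fzero))
      elsewhere : ∀ {x y} → EndpointOf (F fzero) x → y ∈ endpoints F⁺ → x ≢ y
      elsewhere end y∈ refl with ∈-endpoints⁻ F⁺ y∈
      ... | i , end′ = disjoint (λ ()) end end′
      u≢ : ∀ {y} → y ∈ v ∷ endpoints F⁺ → u ≢ y
      u≢ (here refl) u≡v = irrefl G (subst (Adj G u) (≡-sym u≡v) (proj₂ (F fzero)))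
      u≢ (there y∈)      = elsewhere (inj₁ refl) y∈
      v≢ : ∀ {y} → y ∈ endpoints F⁺ → v ≢ y
      v≢ = elsewhere (inj₂ refl)

  endpoints-adjacent : ∀ e {x y} → EndpointOf e x → EndpointOf e y → ∃ λ l → Walk G x y l × l ≤ 1
  endpoints-adjacent e (inj₁ refl) (inj₁ refl) = 0 , [] , z≤n
  endpoints-adjacent e (inj₁ refl) (inj₂ refl) = 1 , proj₂ e ∷ [] , ≤-refl
  endpoints-adjacent e (inj₂ refl) (inj₁ refl) = 1 , sym G (proj₂ e) ∷ [] , ≤-refl
  endpoints-adjacent e (inj₂ refl) (inj₂ refl) = 0 , [] , z≤n

  edgeDist-endpoints : ∀ {e f k x y} → EdgeDist G e f k → EndpointOf e x → EndpointOf f y →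
                       ∃ λ d → Dist G x y d × k ≤ d
  edgeDist-endpoints (a , b , c , d , ux , uy , vx , vy , refl) = λ where
    (inj₁ refl) (inj₁ refl) → a , ux , m⊓n≤m a _
    (inj₁ refl) (inj₂ refl) → b , uy , ≤-trans (m⊓n≤n a _) (m⊓n≤m b _)
    (inj₂ refl) (inj₁ refl) → c , vx , ≤-trans (m⊓n≤n a _) (≤-trans (m⊓n≤n b _) (m⊓n≤m c d))
    (inj₂ refl) (inj₂ refl) → d , vy , ≤-trans (m⊓n≤n a _) (≤-trans (m⊓n≤n b _) (m⊓n≤n c d))

  module _ {k : ℕ} (diam : Diam G k) (1≤k : 1 ≤ k) {m : ℕ} (F : Fin m → Edge G)
           (far : ∀ i j → i ≢ j → EdgeDist G (F i) (F j) k) where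

    endpoints-apart : ∀ {i j x y l} → i ≢ j → EndpointOf (F i) x → EndpointOf (F j) y →
               Walk G x y l → k ≤ l
    endpoints-apart {i} {j} i≢j x∈ y∈ w with edgeDist-endpoints {F i} {F j} (far i j i≢j) x∈ y∈
    ... | d , (_ , shortest) , k≤d = ≤-trans k≤d (shortest _ w)

    endpoints-within-diam : ∀ {i j x y} → i ≢ j → EndpointOf (F i) x → EndpointOf (F j) y →
                     ∃ λ l → Walk G x y l × l ≤ k
    endpoints-within-diam {i} {j} {x} {y} i≢j x∈ y∈ with edgeDist-endpoints {F i} {F j} (far i j i≢j) x∈ y∈
    ... | d , dist , _ = d , proj₁ dist , proj₁ diam x y d dist

    endpoints-disjoint : ∀ {i j x} → i ≢ j → EndpointOf (F i) x → ¬ EndpointOf (F j) x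
    endpoints-disjoint i≢j x∈ x∈′ = 1+n≰n (≤-trans 1≤k (endpoints-apart i≢j x∈ x∈′ []))

    endpoint-not-between : ∀ {x y z} → x ∈ endpoints F → y ∈ endpoints F → z ∈ endpoints F →
                           x ≢ y → y ≢ z → ¬ Between x y z
    endpoint-not-between x∈ y∈ z∈ x≢y y≢z (s , t , p , q , shortest)
      with ∈-endpoints⁻ F x∈ | ∈-endpoints⁻ F y∈ | ∈-endpoints⁻ F z∈
    ... | i , xᵢ | j , yⱼ | l , zₗ with i ≟ᶠ l
    ...   | yes refl = let D , r , D≤1 = endpoints-adjacent (F i) xᵢ zₗ in
      1+n≰n (≤-trans (+-mono-≤ (walk-length-positive x≢y p) (walk-length-positive y≢z q))
                     (≤-trans (shortest D r) D≤1))
    ...   | no i≢l = let D , r , D≤k = endpoints-within-diam i≢l xᵢ zₗ in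
      1+n≰n (≤-trans long (≤-trans (shortest D r) D≤k))
      where
        long : 1 + k ≤ s + t
        long with i ≟ᶠ j
        ... | no i≢j   = subst (_≤ s + t) (+-comm k 1)
                           (+-mono-≤ (endpoints-apart i≢j xᵢ yⱼ p) (walk-length-positive y≢z q))
        ... | yes refl = +-mono-≤ (walk-length-positive x≢y p) (endpoints-apart i≢l yⱼ zₗ q)

proposition4p4 : ∀ {n : ℕ} (G : Graph n) (k : ℕ) → Connected G → Diam G k → 2 ≤ k →
    ∀ (m : ℕ) (F : Fin m → Edge G) →
    (∀ i j → i ≢ j → EdgeDist G (F i) (F j) k) →
    GpAtLeast G (2 * m)
proposition4p4 G k _ diam 2≤k m F far =
    endpoints G F
  , endpoints-unique G F (endpoints-disjoint G diam 1≤k F far)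
  , generalPosition-if-noneBetween G (endpoint-not-between G diam 1≤k F far)
  , ≤-reflexive (≡-sym (length-endpoints G F))
  where
    1≤k : 1 ≤ k
    1≤k = ≤-trans (s≤s z≤n) 2≤k
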